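{- If $L$ is a set of $0.62\,q^3$ lines in $\mathbb{F}_q^3$, then $|P(L)|\geq(1-o(1))\,0.38\,q^3$.
   Context: $\mathbb{F}_q$ is the finite field with $q$ elements; lines are one-dimensional affine subspaces of $\mathbb{F}_q^3$. For a set $L$ of lines, $P(L)=\bigcup_{\ell\in L}\ell$. Here $o(1)$ denotes a quantity tending to $0$ as $q\to\infty$. -}

module Defs where

open import Level using (0ℓ)
open import Data.Nat using (ℕ)
open import Data.Fin using (Fin)
open import Data.Product using (_×_; _,_; ∃)
open import Data.List using (List)
open import Data.List.Membership.Propositional using (_∈_)
open import Data.List.Relation.Unary.AllPairs using (AllPairs)
open import Relation.Nullary using (¬_)
open import Relation.Binary.PropositionalEquality using (_≡_)
open import Algebra.Structures using (IsCommutativeRing)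
open import Function.Bundles using (_↔_)

record FiniteField : Set₁ where
  infixl 6 _+_
  infixl 7 _*_
  field
    Carrier : Set
    _+_ _*_ : Carrier → Carrier → Carrier
    -_      : Carrier → Carrier
    0# 1#   : Carrier
    isCommutativeRing : IsCommutativeRing _≡_ _+_ _*_ -_ 0# 1#
    0≢1     : ¬ (0# ≡ 1#)
    inverse : ∀ x → ¬ (x ≡ 0#) → ∃ λ y → x * y ≡ 1#
    size    : ℕ
    enum    : Fin size ↔ Carrier

module _ (F : FiniteField) where
  open FiniteField F

  Point : Set
  Point = Carrier × Carrier × Carrier

  origin : Point
  origin = 0# , 0# , 0#

  _⊕_ : Point → Point → Point
  (x₁ , y₁ , z₁) ⊕ (x₂ , y₂ , z₂) = (x₁ + x₂) , (y₁ + y₂) , (z₁ + z₂)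

  _·_ : Carrier → Point → Point
  t · (x , y , z) = (t * x) , (t * y) , (t * z)

  record Line : Set where
    constructor line
    field
      base      : Point
      direction : Point
      nonzero   : ¬ (direction ≡ origin)

  _∈ℓ_ : Point → Line → Set
  p ∈ℓ ℓ = ∃ λ t → p ≡ Line.base ℓ ⊕ (t · Line.direction ℓ)

  SameLine : Line → Line → Set
  SameLine ℓ ℓ' = ∀ p → ((p ∈ℓ ℓ → p ∈ℓ ℓ') × (p ∈ℓ ℓ' → p ∈ℓ ℓ))

  -- a list of pairwise distinct lines represents a finite set of lines
  DistinctLines : List Line → Set
  DistinctLines = AllPairs (λ ℓ ℓ' → ¬ SameLine ℓ ℓ')

  InUnion : List Line → Point → Set
  InUnion L p = ∃ λ ℓ → (ℓ ∈ L) × (p ∈ℓ ℓ)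

-- Let c be the number of points of F_q³ outside P(L), and for a pair (a, v) of points let n(a, v) be
-- the number of scalars r with a + r v outside P(L). Invariance of the sum over F_q³ under
-- translations and nonzero dilations computes the first two moments of n over all q⁶ pairs:
-- Σ n = q c q³ and Σ n² = q c (q³ + (q − 1) c). Every line of L is swept out as {a + r v} by
-- q (q − 1) pairs (a, v) with v ≠ 0, on which n vanishes, and distinct lines give distinct pairs.
-- Chebyshev's inequality for the number of zeros of n then gives (q − 1) c |L| ≤ q⁴ (q³ − c), so
-- with |L| ≥ 0.62 q³ the number of covered points is at least 62 (q − 1) q³ / (162 q − 62), which
-- exceeds 0.38 q³ as soon as q ≥ 88.

module Submission where

open import Defs hiding (_⊕_; _·_; _∈ℓ_)
open import Data.List using (List; length)

module FiniteSums where
  open import Data.Nat using (ℕ; zero; suc; _+_; _*_; _≤_; z≤n; s≤s)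
  open import Data.Nat.Properties
    using (+-mono-≤; +-assoc; +-suc; +-identityʳ; *-comm; *-identityˡ; *-identityʳ; *-zeroʳ; *-suc; *-distribˡ-+;
           ≤-total; ≤-reflexive; m≤n⇒∃[o]m+o≡n; m≤m+n; +-cancelʳ-≤; module ≤-Reasoning)
  open import Function using (_∘_)
  open import Data.Nat.Tactic.RingSolver using (solve-∀)
  open import Data.List using (List; []; _∷_; _++_; map; length; cartesianProduct; filter)
  open import Data.List.Properties using (length-++; length-map)
  open import Data.List.Membership.Propositional using (_∈_)
  open import Data.List.Membership.Propositional.Properties using (∈-cartesianProduct⁺)
  open import Data.List.Relation.Unary.Any using (here; there)
  open import Data.List.Relation.Unary.All using (All; []; _∷_)
  import Data.List.Relation.Unary.All as All
  open import Data.List.Relation.Unary.AllPairs using ([]; _∷_)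
  open import Data.List.Relation.Unary.Unique.Propositional using (Unique)
  import Data.List.Relation.Unary.Unique.Propositional.Properties as Unique
  open import Data.Product using (_×_; _,_)
  open import Data.Product.Properties using (≡-dec)
  open import Data.Sum using (inj₁; inj₂)
  open import Data.Empty using (⊥-elim)
  open import Relation.Nullary using (¬?; yes; no)
  open import Relation.Binary.Definitions using (DecidableEquality)
  open import Relation.Binary.PropositionalEquality

  ∑ : {A : Set} → List A → (A → ℕ) → ℕ
  ∑ []       f = 0
  ∑ (x ∷ xs) f = f x + ∑ xs f

  module _ {A : Set} where

    ∑-cong : (xs : List A) {f g : A → ℕ} → (∀ x → f x ≡ g x) → ∑ xs f ≡ ∑ xs g
    ∑-cong []       f≗g = refl
    ∑-cong (x ∷ xs) f≗g = cong₂ _+_ (f≗g x) (∑-cong xs f≗g)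

    ∑-mono-≤ : (xs : List A) {f g : A → ℕ} → (∀ x → f x ≤ g x) → ∑ xs f ≤ ∑ xs g
    ∑-mono-≤ []       f≤g = z≤n
    ∑-mono-≤ (x ∷ xs) f≤g = +-mono-≤ (f≤g x) (∑-mono-≤ xs f≤g)

    ∑-zero : (xs : List A) {f : A → ℕ} → (∀ {x} → x ∈ xs → f x ≡ 0) → ∑ xs f ≡ 0
    ∑-zero []       f≡0 = refl
    ∑-zero (x ∷ xs) f≡0 = cong₂ _+_ (f≡0 (here refl)) (∑-zero xs (f≡0 ∘ there))

    ∑-+ : (xs : List A) (f g : A → ℕ) → ∑ xs (λ x → f x + g x) ≡ ∑ xs f + ∑ xs g
    ∑-+ []       f g = refl
    ∑-+ (x ∷ xs) f g = begin
      f x + g x + ∑ xs (λ x → f x + g x) ≡⟨ cong (f x + g x +_) (∑-+ xs f g) ⟩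
      f x + g x + (∑ xs f + ∑ xs g)      ≡⟨ +-assoc-swap (f x) (g x) (∑ xs f) (∑ xs g) ⟩
      f x + ∑ xs f + (g x + ∑ xs g)      ∎
      where
      open ≡-Reasoning
      +-assoc-swap : ∀ a b c d → a + b + (c + d) ≡ a + c + (b + d)
      +-assoc-swap = solve-∀

    ∑-*ˡ : (xs : List A) (k : ℕ) (f : A → ℕ) → ∑ xs (λ x → k * f x) ≡ k * ∑ xs f
    ∑-*ˡ []       k f = sym (*-zeroʳ k)
    ∑-*ˡ (x ∷ xs) k f = trans (cong (k * f x +_) (∑-*ˡ xs k f)) (sym (*-distribˡ-+ k (f x) (∑ xs f)))

    ∑-*ʳ : (xs : List A) (k : ℕ) (f : A → ℕ) → ∑ xs (λ x → f x * k) ≡ ∑ xs f * k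
    ∑-*ʳ xs k f = trans (∑-cong xs (λ x → *-comm (f x) k)) (trans (∑-*ˡ xs k f) (*-comm k (∑ xs f)))

    ∑-const : (xs : List A) (k : ℕ) → ∑ xs (λ _ → k) ≡ k * length xs
    ∑-const []       k = sym (*-zeroʳ k)
    ∑-const (x ∷ xs) k = trans (cong (k +_) (∑-const xs k)) (sym (*-suc k (length xs)))

    ∑-++ : (xs ys : List A) (f : A → ℕ) → ∑ (xs ++ ys) f ≡ ∑ xs f + ∑ ys f
    ∑-++ []       ys f = refl
    ∑-++ (x ∷ xs) ys f = trans (cong (f x +_) (∑-++ xs ys f)) (sym (+-assoc (f x) (∑ xs f) (∑ ys f)))

  ∑-map : {A B : Set} (g : A → B) (xs : List A) (f : B → ℕ) → ∑ (map g xs) f ≡ ∑ xs (λ x → f (g x))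
  ∑-map g []       f = refl
  ∑-map g (x ∷ xs) f = cong (f (g x) +_) (∑-map g xs f)

  module _ {A B : Set} where

    ∑-swap : (xs : List A) (ys : List B) (f : A → B → ℕ) →
             ∑ xs (λ x → ∑ ys (f x)) ≡ ∑ ys (λ y → ∑ xs (λ x → f x y))
    ∑-swap []       ys f = sym (∑-zero ys (λ _ → refl))
    ∑-swap (x ∷ xs) ys f = trans (cong (∑ ys (f x) +_) (∑-swap xs ys f))
                                 (sym (∑-+ ys (f x) (λ y → ∑ xs (λ x → f x y))))

    ∑-cartesianProduct : (xs : List A) (ys : List B) (f : A × B → ℕ) →
                         ∑ (cartesianProduct xs ys) f ≡ ∑ xs (λ x → ∑ ys (λ y → f (x , y)))
    ∑-cartesianProduct []       ys f = refl
    ∑-cartesianProduct (x ∷ xs) ys f = trans (∑-++ (map (x ,_) ys) _ f)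
      (cong₂ _+_ (∑-map (x ,_) ys f) (∑-cartesianProduct xs ys f))

    length-cartesianProduct : (xs : List A) (ys : List B) →
                              length (cartesianProduct xs ys) ≡ length xs * length ys
    length-cartesianProduct []       ys = refl
    length-cartesianProduct (x ∷ xs) ys = trans (length-++ (map (x ,_) ys))
      (cong₂ _+_ (length-map (x ,_) ys) (length-cartesianProduct xs ys))

  record Enumeration (A : Set) : Set where
    field
      _≟_      : DecidableEquality A
      elements : List A
      unique   : Unique elements
      complete : ∀ x → x ∈ elements

  ×-enumeration : {A B : Set} → Enumeration A → Enumeration B → Enumeration (A × B)
  ×-enumeration E E′ = record
    { _≟_      = ≡-dec (E._≟_) (E′._≟_)
    ; elements = cartesianProduct E.elements E′.elements
    ; unique   = Unique.cartesianProduct⁺ E.unique E′.unique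
    ; complete = λ (x , y) → ∈-cartesianProduct⁺ (E.complete x) (E′.complete y)
    }
    where
    module E = Enumeration E
    module E′ = Enumeration E′

  module Enumerated {A : Set} (E : Enumeration A) where
    open Enumeration E

    δ : A → A → ℕ
    δ x y with x ≟ y
    ... | yes _ = 1
    ... | no  _ = 0

    δ-refl : ∀ x → δ x x ≡ 1
    δ-refl x with x ≟ x
    ... | yes _   = refl
    ... | no  x≢x = ⊥-elim (x≢x refl)

    δ-≢ : ∀ {x y} → x ≢ y → δ x y ≡ 0
    δ-≢ {x} {y} x≢y with x ≟ y
    ... | yes x≡y = ⊥-elim (x≢y x≡y)
    ... | no  _   = refl

    δ-cong : ∀ {x y u v} → (x ≡ y → u ≡ v) → (u ≡ v → x ≡ y) → δ x y ≡ δ u v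
    δ-cong {x} {y} {u} {v} ⇒ ⇐ with x ≟ y | u ≟ v
    ... | yes _   | yes _   = refl
    ... | no  _   | no  _   = refl
    ... | yes x≡y | no  u≢v = ⊥-elim (u≢v (⇒ x≡y))
    ... | no  x≢y | yes u≡v = ⊥-elim (x≢y (⇐ u≡v))

    private
      ∑-δ-∉ : ∀ xs z (f : A → ℕ) → All (z ≢_) xs → ∑ xs (λ y → δ y z * f y) ≡ 0
      ∑-δ-∉ []       z f []           = refl
      ∑-δ-∉ (x ∷ xs) z f (z≢x ∷ z∉xs) =
        cong₂ (λ d s → d * f x + s) (δ-≢ (z≢x ∘ sym)) (∑-δ-∉ xs z f z∉xs)

    ∑-δ : ∀ z (f : A → ℕ) → ∑ elements (λ y → δ y z * f y) ≡ f z
    ∑-δ z f = go elements unique (complete z)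
      where
      go : ∀ xs → Unique xs → z ∈ xs → ∑ xs (λ y → δ y z * f y) ≡ f z
      go (x ∷ xs) (x∉xs ∷ _) (here refl) rewrite δ-refl x | ∑-δ-∉ xs x f x∉xs =
        trans (+-identityʳ _) (+-identityʳ (f x))
      go (x ∷ xs) (x∉xs ∷ u) (there z∈xs) rewrite δ-≢ {x} {z} (λ { refl → All.lookup x∉xs z∈xs refl }) = go xs u z∈xs

    ∑-δ-one : ∀ z → ∑ elements (λ y → δ y z) ≡ 1
    ∑-δ-one z = trans (∑-cong elements (λ y → sym (*-identityʳ (δ y z)))) (∑-δ z (λ _ → 1))

    ∑-bijection : (σ τ : A → A) → (∀ x → τ (σ x) ≡ x) → (∀ y → σ (τ y) ≡ y) →
                  ∀ (f : A → ℕ) → ∑ elements (f ∘ σ) ≡ ∑ elements f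
    ∑-bijection σ τ τσ στ f = begin
      ∑ elements (f ∘ σ)                                         ≡⟨ ∑-cong elements (λ x → ∑-δ (σ x) f) ⟨
      ∑ elements (λ x → ∑ elements (λ y → δ y (σ x) * f y))      ≡⟨ ∑-swap elements elements _ ⟩
      ∑ elements (λ y → ∑ elements (λ x → δ y (σ x) * f y))      ≡⟨ ∑-cong elements (λ y → ∑-cong elements (λ x →
                                                                      cong (_* f y) (δ-cong (λ { refl → sym (τσ x) })
                                                                                            (λ { refl → sym (στ y) })))) ⟩
      ∑ elements (λ y → ∑ elements (λ x → δ x (τ y) * f y))      ≡⟨ ∑-cong elements (λ y → ∑-δ (τ y) (λ _ → f y)) ⟩
      ∑ elements f                                               ∎
      where open ≡-Reasoning

    count : A → List A → ℕ
    count y xs = ∑ xs (δ y)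

    count-elements : ∀ z → count z elements ≡ 1
    count-elements z = trans (∑-cong elements (λ y → δ-cong sym sym)) (∑-δ-one z)

    count+length-filter : ∀ z xs → count z xs + length (filter (λ y → ¬? (z ≟ y)) xs) ≡ length xs
    count+length-filter z []       = refl
    count+length-filter z (x ∷ xs) with z ≟ x
    ... | yes _ = cong suc (count+length-filter z xs)
    ... | no  _ = trans (+-suc _ _) (cong suc (count+length-filter z xs))

    ∑-count : (xs : List A) → ∑ elements (λ y → count y xs) ≡ length xs
    ∑-count xs = begin
      ∑ elements (λ y → ∑ xs (δ y))  ≡⟨ ∑-swap elements xs δ ⟩
      ∑ xs (λ x → ∑ elements (λ y → δ y x)) ≡⟨ ∑-cong xs ∑-δ-one ⟩
      ∑ xs (λ _ → 1)                 ≡⟨ ∑-const xs 1 ⟩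
      1 * length xs                  ≡⟨ *-identityˡ (length xs) ⟩
      length xs                      ∎
      where open ≡-Reasoning

    count-∉ : ∀ y xs → All (y ≢_) xs → count y xs ≡ 0
    count-∉ y []       []           = refl
    count-∉ y (x ∷ xs) (y≢x ∷ y∉xs) = cong₂ _+_ (δ-≢ y≢x) (count-∉ y xs y∉xs)

    count-unique : ∀ y {xs} → Unique xs → count y xs ≤ 1
    count-unique y {[]}     []           = z≤n
    count-unique y {x ∷ xs} (x∉xs ∷ u) with y ≟ x
    ... | yes refl rewrite count-∉ y xs x∉xs = s≤s z≤n
    ... | no  _    = count-unique y u

    count≢0⇒∈ : ∀ y xs → count y xs ≢ 0 → y ∈ xs
    count≢0⇒∈ y []       c≢0 = ⊥-elim (c≢0 refl)
    count≢0⇒∈ y (x ∷ xs) c≢0 with y ≟ x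
    ... | yes y≡x = here y≡x
    ... | no  _   = there (count≢0⇒∈ y xs c≢0)

  2*m*n≤m*m+n*n : ∀ m n → 2 * (m * n) ≤ m * m + n * n
  2*m*n≤m*m+n*n m n with ≤-total m n
  ... | inj₁ m≤n with k , refl ← m≤n⇒∃[o]m+o≡n m≤n = subst (2 * (m * (m + k)) ≤_) (sym (square-gap m k)) (m≤m+n _ _)
    where
    square-gap : ∀ m k → m * m + (m + k) * (m + k) ≡ 2 * (m * (m + k)) + k * k
    square-gap = solve-∀
  ... | inj₂ n≤m with k , refl ← m≤n⇒∃[o]m+o≡n n≤m = subst (2 * ((n + k) * n) ≤_) (sym (square-gap n k)) (m≤m+n _ _)
    where
    square-gap : ∀ n k → (n + k) * (n + k) + n * n ≡ 2 * ((n + k) * n) + k * k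
    square-gap = solve-∀

  module _ {A : Set} (E : Enumeration A) where
    open Enumeration E
    open Enumerated E

    chebyshev-zeros : (f : A → ℕ) (R : List A) → Unique R → (∀ {x} → x ∈ R → f x ≡ 0) →
      let N = length elements; S₁ = ∑ elements f; S₂ = ∑ elements (λ x → f x * f x) in
      length R * (S₁ * S₁) + N * (S₁ * S₁) ≤ N * N * S₂
    chebyshev-zeros f R unique-R R⊆zeros =
      +-cancelʳ-≤ (N * (S₁ * S₁)) _ _ (subst₂ _≤_ (regroup-lhs (length R) N S₁) (regroup-rhs N S₁ S₂) summed)
      where
      N = length elements
      S₁ = ∑ elements f
      S₂ = ∑ elements (λ x → f x * f x)

      -- (N f x − S₁)² ≥ 0, where the extra S₁² at a listed zero is paid for by f x = 0.
      pointwise : ∀ x → S₁ * S₁ * count x R + 2 * (N * S₁) * f x ≤ N * N * (f x * f x) + S₁ * S₁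
      pointwise x = bound (count x R) (count-unique x unique-R) (λ c≢0 → R⊆zeros (count≢0⇒∈ x R c≢0))
        where
        bound : ∀ i → i ≤ 1 → (i ≢ 0 → f x ≡ 0) → S₁ * S₁ * i + 2 * (N * S₁) * f x ≤ N * N * (f x * f x) + S₁ * S₁
        bound zero    _ _    = subst₂ _≤_ (amgm-lhs S₁ N (f x)) (amgm-rhs S₁ N (f x)) (2*m*n≤m*m+n*n (N * f x) S₁)
          where
          amgm-lhs : ∀ S N n → 2 * (N * n * S) ≡ S * S * 0 + 2 * (N * S) * n
          amgm-lhs = solve-∀
          amgm-rhs : ∀ S N n → N * n * (N * n) + S * S ≡ N * N * (n * n) + S * S
          amgm-rhs = solve-∀
        bound (suc zero) _ fx≡0 rewrite fx≡0 (λ ()) = ≤-reflexive (zero-case S₁ N)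
          where
          zero-case : ∀ S N → S * S * 1 + 2 * (N * S) * 0 ≡ N * N * (0 * 0) + S * S
          zero-case = solve-∀
        bound (suc (suc _)) (s≤s ()) _

      summed : S₁ * S₁ * length R + 2 * (N * S₁) * S₁ ≤ N * N * S₂ + S₁ * S₁ * N
      summed = begin
        S₁ * S₁ * length R + 2 * (N * S₁) * S₁
          ≡⟨ cong₂ _+_ (cong (S₁ * S₁ *_) (∑-count R)) refl ⟨
        S₁ * S₁ * ∑ elements (λ x → count x R) + 2 * (N * S₁) * S₁
          ≡⟨ cong₂ _+_ (∑-*ˡ elements (S₁ * S₁) _) (∑-*ˡ elements (2 * (N * S₁)) f) ⟨
        ∑ elements (λ x → S₁ * S₁ * count x R) + ∑ elements (λ x → 2 * (N * S₁) * f x)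
          ≡⟨ ∑-+ elements _ _ ⟨
        ∑ elements (λ x → S₁ * S₁ * count x R + 2 * (N * S₁) * f x)
          ≤⟨ ∑-mono-≤ elements pointwise ⟩
        ∑ elements (λ x → N * N * (f x * f x) + S₁ * S₁)
          ≡⟨ ∑-+ elements _ _ ⟩
        ∑ elements (λ x → N * N * (f x * f x)) + ∑ elements (λ _ → S₁ * S₁)
          ≡⟨ cong₂ _+_ (∑-*ˡ elements (N * N) _) (∑-const elements (S₁ * S₁)) ⟩
        N * N * S₂ + S₁ * S₁ * N
          ∎
        where open ≤-Reasoning

      regroup-lhs : ∀ r N S → S * S * r + 2 * (N * S) * S ≡ r * (S * S) + N * (S * S) + N * (S * S)
      regroup-lhs = solve-∀
      regroup-rhs : ∀ N S S₂ → N * N * S₂ + S * S * N ≡ N * N * S₂ + N * (S * S)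
      regroup-rhs = solve-∀


module DensityBounds where
  open import Data.Nat using (zero; suc; _+_; _*_; _≤_; z≤n)
  open import Data.Nat.Properties
    using (≤-trans; ≤-reflexive; *-cancelˡ-≤; *-cancelʳ-≤; +-cancelʳ-≤; *-monoʳ-≤; *-monoˡ-≤; +-monoˡ-≤; +-monoʳ-≤; m≤m+n;
           module ≤-Reasoning)
  open import Data.Nat.Tactic.RingSolver using (solve-∀)
  open import Relation.Binary.PropositionalEquality

  -- Divide the moment inequality by q c Q²; then Q = c + m and q = p + 1 leave q² p c L ≤ Q² m.
  missed-bound : ∀ {q Q} p c m L → q ≡ suc p → Q ≡ q * (q * q) → c + m ≡ Q →
    let S₁ = q * c * Q in
    L * (q * p) * (S₁ * S₁) + Q * Q * (S₁ * S₁) ≤ Q * Q * (Q * Q) * (q * c * (Q + p * c)) →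
    p * c * L ≤ q * Q * m
  missed-bound p zero m L refl refl _ _ = ≤-trans (≤-reflexive (zero-lhs p L)) z≤n
    where
    zero-lhs : ∀ p L → p * 0 * L ≡ 0
    zero-lhs = solve-∀
  missed-bound p c@(suc _) m L refl refl c+m≡Q chebyshev =
    *-cancelˡ-≤ (q * q) (subst₂ _≤_ (sym (regroup-lhs L p q c)) (sym (regroup-rhs q m)) reduced)
    where
    q = suc p
    Q = q * (q * q)
    open ≤-Reasoning

    divided : L * p * (q * q) * c + Q * Q * (q * c) ≤ Q * Q * (Q + p * c)
    divided = *-cancelˡ-≤ (q * c * (Q * Q))
      (subst₂ _≤_ (factor-lhs L p q c Q) (factor-rhs q c Q p) chebyshev)
      where
      factor-lhs : ∀ L p q c Q → L * (q * p) * (q * c * Q * (q * c * Q)) + Q * Q * (q * c * Q * (q * c * Q))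
                                 ≡ q * c * (Q * Q) * (L * p * (q * q) * c + Q * Q * (q * c))
      factor-lhs = solve-∀
      factor-rhs : ∀ q c Q p → Q * Q * (Q * Q) * (q * c * (Q + p * c)) ≡ q * c * (Q * Q) * (Q * Q * (Q + p * c))
      factor-rhs = solve-∀

    reduced : L * p * (q * q) * c ≤ Q * Q * m
    reduced = +-cancelʳ-≤ (Q * Q * (p * c) + Q * Q * c) _ _ (begin
      L * p * (q * q) * c + (Q * Q * (p * c) + Q * Q * c) ≡⟨ split-q (L * p * (q * q) * c) Q p c ⟩
      L * p * (q * q) * c + Q * Q * (q * c)               ≤⟨ divided ⟩
      Q * Q * (Q + p * c)                                  ≡⟨ cong (λ x → Q * Q * (x + p * c)) c+m≡Q ⟨
      Q * Q * (c + m + p * c)                              ≡⟨ split-Q Q c m p ⟩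
      Q * Q * m + (Q * Q * (p * c) + Q * Q * c)            ∎)
      where
      split-q : ∀ X Q p c → X + (Q * Q * (p * c) + Q * Q * c) ≡ X + Q * Q * (suc p * c)
      split-q = solve-∀
      split-Q : ∀ Q c m p → Q * Q * (c + m + p * c) ≡ Q * Q * m + (Q * Q * (p * c) + Q * Q * c)
      split-Q = solve-∀

    regroup-lhs : ∀ L p q c → q * q * (p * c * L) ≡ L * p * (q * q) * c
    regroup-lhs = solve-∀
    regroup-rhs : ∀ q m → q * q * (q * (q * (q * q)) * m) ≡ q * (q * q) * (q * (q * q)) * m
    regroup-rhs = solve-∀

  coefficient-bound : ∀ p → 87 ≤ p → 38 * (100 * suc p + 62 * p) ≤ 6200 * p
  coefficient-bound p 87≤p = begin
    38 * (100 * suc p + 62 * p) ≡⟨ expand p ⟩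
    6156 * p + 3800             ≤⟨ +-monoʳ-≤ (6156 * p) (≤-trans (m≤m+n 3800 28) (*-monoʳ-≤ 44 87≤p)) ⟩
    6156 * p + 44 * p           ≡⟨ collect p ⟩
    6200 * p                    ∎
    where
    open ≤-Reasoning
    expand : ∀ p → 38 * (100 * suc p + 62 * p) ≡ 6156 * p + 3800
    expand = solve-∀
    collect : ∀ p → 6156 * p + 44 * p ≡ 6200 * p
    collect = solve-∀

  -- From 62 Q ≤ 100 L one gets 62 p c ≤ 100 q m, i.e. m ≥ 62 p Q / (100 q + 62 p), and this ratio
  -- exceeds 0.38 once p ≥ 87.
  covered-density : ∀ {q} p c m L Q → q ≡ suc p → 87 ≤ p → c + m ≡ Q → 62 * Q ≤ 100 * L →
    p * c * L ≤ q * Q * m → 38 * Q ≤ 100 * m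
  covered-density p c m L zero      _    _    _     _        _       = z≤n
  covered-density p c m L Q@(suc _) refl 87≤p c+m≡Q 62Q≤100L missed≤ = *-cancelʳ-≤ _ _ (Q * W) (begin
    38 * Q * (Q * W)                               ≡⟨ regroup Q W ⟩
    Q * Q * (38 * W)                               ≤⟨ *-monoʳ-≤ (Q * Q) (coefficient-bound p 87≤p) ⟩
    Q * Q * (6200 * p)                             ≡⟨ regroup′ Q p ⟩
    100 * (p * Q) * (62 * Q)                       ≡⟨ cong (λ x → 100 * (p * Q) * (62 * x)) c+m≡Q ⟨
    100 * (p * Q) * (62 * (c + m))                 ≡⟨ split p Q c m ⟩
    100 * (62 * Q) * (p * c) + 6200 * (p * Q * m)  ≤⟨ +-monoˡ-≤ _ (*-monoˡ-≤ (p * c) (*-monoʳ-≤ 100 62Q≤100L)) ⟩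
    100 * (100 * L) * (p * c) + 6200 * (p * Q * m) ≡⟨ regroup″ L p c (6200 * (p * Q * m)) ⟩
    10000 * (p * c * L) + 6200 * (p * Q * m)       ≤⟨ +-monoˡ-≤ _ (*-monoʳ-≤ 10000 missed≤) ⟩
    10000 * (suc p * Q * m) + 6200 * (p * Q * m)   ≡⟨ collect p Q m ⟩
    100 * m * (Q * W)                              ∎)
    where
    open ≤-Reasoning
    W = 100 * suc p + 62 * p
    regroup : ∀ Q W → 38 * Q * (Q * W) ≡ Q * Q * (38 * W)
    regroup = solve-∀
    regroup′ : ∀ Q p → Q * Q * (6200 * p) ≡ 100 * (p * Q) * (62 * Q)
    regroup′ = solve-∀
    split : ∀ p Q c m → 100 * (p * Q) * (62 * (c + m)) ≡ 100 * (62 * Q) * (p * c) + 6200 * (p * Q * m)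
    split = solve-∀
    regroup″ : ∀ L p c X → 100 * (100 * L) * (p * c) + X ≡ 10000 * (p * c * L) + X
    regroup″ = solve-∀
    collect : ∀ p Q m → 10000 * (suc p * Q * m) + 6200 * (p * Q * m) ≡ 100 * m * (Q * (100 * suc p + 62 * p))
    collect = solve-∀


module AffineSpace (F : FiniteField) where
  open FiniteSums
  open import Level using (0ℓ)
  open import Data.Nat as ℕ using (ℕ; suc)
  import Data.Fin as Fin
  open import Data.List using (List; []; _∷_; map; length; cartesianProduct; concat; filter; allFin)
  open import Data.List.Properties using (length-map; length-tabulate; length-++)
  open import Data.List.Membership.Propositional using (_∈_)
  open import Data.List.Membership.Propositional.Properties
    using (∈-map⁺; ∈-map⁻; ∈-allFin; ∈-cartesianProduct⁻; ∈-filter⁻; ∈-concat⁻′)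
  open import Data.List.Relation.Unary.Any using (here; there; any?; satisfied)
  import Data.List.Relation.Unary.Any as Any
  import Data.List.Relation.Unary.All as All
  import Data.List.Relation.Unary.All.Properties as All
  import Data.List.Relation.Unary.AllPairs as AllPairs
  import Data.List.Relation.Unary.AllPairs.Properties as AllPairs
  open import Data.List.Relation.Unary.Unique.Propositional using (Unique)
  import Data.List.Relation.Unary.Unique.Propositional.Properties as Unique
  open import Data.List.Relation.Binary.Disjoint.Propositional using (Disjoint)
  open import Data.Product using (_×_; _,_; proj₁; proj₂; ∃)
  open import Data.Empty using (⊥-elim)
  open import Function using (_∘_)
  open import Function.Bundles using (Inverse; Injection)
  open import Function.Properties.Inverse using (↔-sym; ↔⇒↣)
  open import Relation.Nullary using (¬_; ¬?; yes; no; Dec)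
  open import Relation.Nullary.Decidable using (via-injection)
  open import Relation.Binary.Definitions using (DecidableEquality)
  open import Relation.Binary.PropositionalEquality
  open import Algebra.Bundles using (CommutativeRing)
  open FiniteField F

  ring : CommutativeRing 0ℓ 0ℓ
  ring = record { isCommutativeRing = isCommutativeRing }

  private module R = CommutativeRing ring
  open import Algebra.Properties.Group R.+-group
    using (∙-cancelˡ; //-rightDividesˡ; //-rightDividesʳ; x∙y⁻¹≈ε⇒x≈y)

  infixl 6 _-_
  _-_ : Carrier → Carrier → Carrier
  x - y = x + - y

  +-shift : ∀ t u → t + (u - t) ≡ u
  +-shift t u = trans (R.+-comm t (u - t)) (//-rightDividesˡ t u)

  -≢0 : ∀ {r s} → r ≢ s → s - r ≢ 0#
  -≢0 {r} {s} r≢s s-r≡0 = r≢s (sym (x∙y⁻¹≈ε⇒x≈y s r s-r≡0))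

  _≟_ : DecidableEquality Carrier
  _≟_ = via-injection (↔⇒↣ (↔-sym enum)) Fin._≟_

  scalars : Enumeration Carrier
  scalars = record
    { _≟_      = _≟_
    ; elements = map to (allFin size)
    ; unique   = Unique.map⁺ (Injection.injective (↔⇒↣ enum)) (Unique.allFin⁺ size)
    ; complete = λ x → subst (_∈ map to (allFin size)) (strictlyInverseˡ x) (∈-map⁺ to (∈-allFin (from x)))
    }
    where open Inverse enum

  open Enumeration scalars public using () renaming (elements to allScalars)

  length-scalars : length allScalars ≡ size
  length-scalars = trans (length-map _ (allFin size)) (length-tabulate _)

  *-cancelʳ-≢0 : ∀ {x y d} → x * d ≡ y * d → d ≢ 0# → x ≡ y
  *-cancelʳ-≢0 {x} {y} {d} xd≡yd d≢0 with d⁻¹ , dd⁻¹≡1 ← inverse d d≢0 = begin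
    x              ≡⟨ R.*-identityʳ x ⟨
    x * 1#         ≡⟨ cong (x *_) dd⁻¹≡1 ⟨
    x * (d * d⁻¹)  ≡⟨ R.*-assoc x d d⁻¹ ⟨
    x * d * d⁻¹    ≡⟨ cong (_* d⁻¹) xd≡yd ⟩
    y * d * d⁻¹    ≡⟨ R.*-assoc y d d⁻¹ ⟩
    y * (d * d⁻¹)  ≡⟨ cong (y *_) dd⁻¹≡1 ⟩
    y * 1#         ≡⟨ R.*-identityʳ y ⟩
    y              ∎
    where open ≡-Reasoning

  infixl 6 _⊕_
  infixr 7 _·_
  infix  4 _∈ℓ_

  _⊕_ : Point F → Point F → Point F
  _⊕_ = Defs._⊕_ F

  _·_ : Carrier → Point F → Point F
  _·_ = Defs._·_ F

  _∈ℓ_ : Point F → Line F → Set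
  _∈ℓ_ = Defs._∈ℓ_ F

  ⊖_ : Point F → Point F
  ⊖ (x , y , z) = - x , - y , - z

  private
    triple : ∀ {x₁ x₂ x₃ y₁ y₂ y₃ : Carrier} → x₁ ≡ y₁ → x₂ ≡ y₂ → x₃ ≡ y₃ → (x₁ , x₂ , x₃) ≡ (y₁ , y₂ , y₃)
    triple refl refl refl = refl

  ⊕-⊖-cancel : ∀ a w → a ⊕ w ⊕ ⊖ w ≡ a
  ⊕-⊖-cancel (a₁ , a₂ , a₃) (w₁ , w₂ , w₃) =
    triple (//-rightDividesʳ w₁ a₁) (//-rightDividesʳ w₂ a₂) (//-rightDividesʳ w₃ a₃)

  ⊖-⊕-cancel : ∀ a w → a ⊕ ⊖ w ⊕ w ≡ a
  ⊖-⊕-cancel (a₁ , a₂ , a₃) (w₁ , w₂ , w₃) =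
    triple (//-rightDividesˡ w₁ a₁) (//-rightDividesˡ w₂ a₂) (//-rightDividesˡ w₃ a₃)

  ⊕-cancelˡ : ∀ a {u v} → a ⊕ u ≡ a ⊕ v → u ≡ v
  ⊕-cancelˡ (a₁ , a₂ , a₃) {u₁ , u₂ , u₃} {v₁ , v₂ , v₃} e =
    triple (∙-cancelˡ a₁ u₁ v₁ (cong proj₁ e)) (∙-cancelˡ a₂ u₂ v₂ (cong (proj₁ ∘ proj₂) e))
           (∙-cancelˡ a₃ u₃ v₃ (cong (proj₂ ∘ proj₂) e))

  ·-assoc : ∀ x y v → x · y · v ≡ (x * y) · v
  ·-assoc x y (v₁ , v₂ , v₃) = triple (sym (R.*-assoc x y v₁)) (sym (R.*-assoc x y v₂)) (sym (R.*-assoc x y v₃))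

  ·-identityˡ : ∀ v → 1# · v ≡ v
  ·-identityˡ (v₁ , v₂ , v₃) = triple (R.*-identityˡ v₁) (R.*-identityˡ v₂) (R.*-identityˡ v₃)

  ⊕-·-distrib : ∀ a x y v → a ⊕ x · v ⊕ y · v ≡ a ⊕ (x + y) · v
  ⊕-·-distrib (a₁ , a₂ , a₃) x y (v₁ , v₂ , v₃) = triple (distrib a₁ v₁) (distrib a₂ v₂) (distrib a₃ v₃)
    where
    distrib : ∀ a v → a + x * v + y * v ≡ a + (x + y) * v
    distrib a v = trans (R.+-assoc a (x * v) (y * v)) (cong (a +_) (sym (R.distribʳ v x y)))

  ⊕-comm : ∀ a b → a ⊕ b ≡ b ⊕ a
  ⊕-comm (a₁ , a₂ , a₃) (b₁ , b₂ , b₃) = triple (R.+-comm a₁ b₁) (R.+-comm a₂ b₂) (R.+-comm a₃ b₃)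

  ⊕-·-shift : ∀ a r s v → a ⊕ r · v ⊕ (s - r) · v ≡ a ⊕ s · v
  ⊕-·-shift a r s v = trans (⊕-·-distrib a r (s - r) v) (cong (λ x → a ⊕ x · v) (+-shift r s))

  ·-cancelʳ : ∀ {x y} d → x · d ≡ y · d → d ≢ origin F → x ≡ y
  ·-cancelʳ (d₁ , d₂ , d₃) e d≢0 with d₁ ≟ 0# | d₂ ≟ 0# | d₃ ≟ 0#
  ... | no d₁≢0 | _       | _       = *-cancelʳ-≢0 (cong proj₁ e) d₁≢0
  ... | yes _   | no d₂≢0 | _       = *-cancelʳ-≢0 (cong (proj₁ ∘ proj₂) e) d₂≢0
  ... | yes _   | yes _   | no d₃≢0 = *-cancelʳ-≢0 (cong (proj₂ ∘ proj₂) e) d₃≢0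
  ... | yes d₁≡0 | yes d₂≡0 | yes d₃≡0 = ⊥-elim (d≢0 (triple d₁≡0 d₂≡0 d₃≡0))

  ·-inverse : ∀ {x x⁻¹} → x * x⁻¹ ≡ 1# → ∀ v → x⁻¹ · x · v ≡ v
  ·-inverse {x} {x⁻¹} xx⁻¹≡1 v = begin
    x⁻¹ · x · v    ≡⟨ ·-assoc x⁻¹ x v ⟩
    (x⁻¹ * x) · v  ≡⟨ cong (_· v) (trans (R.*-comm x⁻¹ x) xx⁻¹≡1) ⟩
    1# · v         ≡⟨ ·-identityˡ v ⟩
    v              ∎
    where open ≡-Reasoning

  points : Enumeration (Point F)
  points = ×-enumeration scalars (×-enumeration scalars scalars)

  open Enumeration points public using () renaming (elements to allPoints)

  length-points : length allPoints ≡ size ℕ.* (size ℕ.* size)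
  length-points = trans (length-cartesianProduct allScalars (cartesianProduct allScalars allScalars))
    (cong₂ ℕ._*_ length-scalars (trans (length-cartesianProduct allScalars allScalars)
                                       (cong₂ ℕ._*_ length-scalars length-scalars)))

  ∑-translate : ∀ w (f : Point F → ℕ) → ∑ allPoints (λ a → f (a ⊕ w)) ≡ ∑ allPoints f
  ∑-translate w = Enumerated.∑-bijection points (_⊕ w) (_⊕ ⊖ w) (λ a → ⊕-⊖-cancel a w) (λ a → ⊖-⊕-cancel a w)

  ∑-dilate : ∀ {x} → x ≢ 0# → ∀ (f : Point F → ℕ) → ∑ allPoints (λ v → f (x · v)) ≡ ∑ allPoints f
  ∑-dilate {x} x≢0 with x⁻¹ , xx⁻¹≡1 ← inverse x x≢0 =
    Enumerated.∑-bijection points (x ·_) (x⁻¹ ·_) (·-inverse xx⁻¹≡1)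
                                         (·-inverse (trans (R.*-comm x⁻¹ x) xx⁻¹≡1))

  ∑-sweep : ∀ b {x} → x ≢ 0# → ∀ (f : Point F → ℕ) → ∑ allPoints (λ v → f (b ⊕ x · v)) ≡ ∑ allPoints f
  ∑-sweep b {x} x≢0 f = begin
    ∑ allPoints (λ v → f (b ⊕ x · v)) ≡⟨ ∑-dilate x≢0 (λ u → f (b ⊕ u)) ⟩
    ∑ allPoints (λ u → f (b ⊕ u))     ≡⟨ ∑-cong allPoints (λ u → cong f (⊕-comm b u)) ⟩
    ∑ allPoints (λ u → f (u ⊕ b))     ≡⟨ ∑-translate b f ⟩
    ∑ allPoints f                     ∎
    where open ≡-Reasoning

  _∈ℓ?_ : ∀ p ℓ → Dec (p ∈ℓ ℓ)
  p ∈ℓ? ℓ with any? (λ t → Enumeration._≟_ points p (Line.base ℓ ⊕ t · Line.direction ℓ)) allScalars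
  ... | yes on  = yes (satisfied on)
  ... | no  off = no λ (t , e) → off (Any.map (λ { refl → e }) (Enumeration.complete scalars t))

  inUnion? : ∀ L p → Dec (InUnion F L p)
  inUnion? []      p = no λ ()
  inUnion? (ℓ ∷ L) p with p ∈ℓ? ℓ | inUnion? L p
  ... | yes p∈ℓ | _                = yes (ℓ , here refl , p∈ℓ)
  ... | no  _   | yes (ℓ′ , m , h) = yes (ℓ′ , there m , h)
  ... | no  p∉ℓ | no  p∉L          = no λ { (_ , here refl , p∈ℓ) → p∉ℓ p∈ℓ ; (ℓ′ , there m , h) → p∉L (ℓ′ , m , h) }

  units : List Carrier
  units = filter (λ s → ¬? (0# ≟ s)) allScalars

  suc-length-units : suc (length units) ≡ size
  suc-length-units = trans (cong (ℕ._+ length units) (sym (Enumerated.count-elements scalars 0#)))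
    (trans (Enumerated.count+length-filter scalars 0# allScalars) length-scalars)

  -- (t , s) with s ≠ 0 gives a point of the line and a nonzero multiple of its direction, so the
  -- pairs (a , v) in representations ℓ sweep out ℓ as {a + r v}.
  representation : Line F → Carrier × Carrier → Point F × Point F
  representation (line b d _) (t , s) = b ⊕ t · d , s · d

  representations : Line F → List (Point F × Point F)
  representations ℓ = map (representation ℓ) (cartesianProduct allScalars units)

  private
    representation⁻ : ∀ ℓ {a v} → (a , v) ∈ representations ℓ →
                      ∃ λ ((t , s) : Carrier × Carrier) → s ≢ 0# × (a , v) ≡ representation ℓ (t , s)
    representation⁻ ℓ m with (t , s) , ts∈ , refl ← ∈-map⁻ (representation ℓ) m =
      (t , s) , (λ s≡0 → s∈units .proj₂ (sym s≡0)) , refl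
      where
      s∈units = ∈-filter⁻ (λ s → ¬? (0# ≟ s)) {xs = allScalars} (∈-cartesianProduct⁻ allScalars units ts∈ .proj₂)

  representation-injective : ∀ ℓ {x y} → representation ℓ x ≡ representation ℓ y → x ≡ y
  representation-injective (line b d d≢0) {t , s} {t′ , s′} e =
    cong₂ _,_ (·-cancelʳ d (⊕-cancelˡ b (cong proj₁ e)) d≢0) (·-cancelʳ d (cong proj₂ e) d≢0)

  representation-on-line : ∀ ℓ {a v} → (a , v) ∈ representations ℓ → ∀ r → a ⊕ r · v ∈ℓ ℓ
  representation-on-line ℓ@(line b d _) m r with (t , s) , _ , refl ← representation⁻ ℓ m =
    t + r * s , trans (cong (b ⊕ t · d ⊕_) (·-assoc r s d)) (⊕-·-distrib b t (r * s) d)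

  representation-spans : ∀ ℓ {a v p} → (a , v) ∈ representations ℓ → p ∈ℓ ℓ → ∃ λ r → p ≡ a ⊕ r · v
  representation-spans ℓ@(line b d _) m (u , refl) with (t , s) , s≢0 , refl ← representation⁻ ℓ m
                                                   with s⁻¹ , ss⁻¹≡1 ← inverse s s≢0 = (u - t) * s⁻¹ , (begin
    b ⊕ u · d                           ≡⟨ cong (λ x → b ⊕ x · d) (+-shift t u) ⟨
    b ⊕ (t + (u - t)) · d               ≡⟨ cong (λ x → b ⊕ (t + x) · d) (*-cancel-inverse (u - t)) ⟨
    b ⊕ (t + (u - t) * s⁻¹ * s) · d     ≡⟨ ⊕-·-distrib b t ((u - t) * s⁻¹ * s) d ⟨
    b ⊕ t · d ⊕ ((u - t) * s⁻¹ * s) · d ≡⟨ cong (b ⊕ t · d ⊕_) (·-assoc ((u - t) * s⁻¹) s d) ⟨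
    b ⊕ t · d ⊕ ((u - t) * s⁻¹) · s · d ∎)
    where
    open ≡-Reasoning
    *-cancel-inverse : ∀ x → x * s⁻¹ * s ≡ x
    *-cancel-inverse x = trans (R.*-assoc x s⁻¹ s) (trans (cong (x *_) (trans (R.*-comm s⁻¹ s) ss⁻¹≡1)) (R.*-identityʳ x))

  representations-unique : ∀ ℓ → Unique (representations ℓ)
  representations-unique ℓ = Unique.map⁺ (representation-injective ℓ)
    (Unique.cartesianProduct⁺ (Enumeration.unique scalars) (Unique.filter⁺ (λ s → ¬? (0# ≟ s)) (Enumeration.unique scalars)))

  representations-disjoint : ∀ ℓ ℓ′ → ¬ SameLine F ℓ ℓ′ → Disjoint (representations ℓ) (representations ℓ′)
  representations-disjoint ℓ ℓ′ ℓ≠ℓ′ (m , m′) = ℓ≠ℓ′ λ p →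
    (λ p∈ℓ  → let r , e = representation-spans ℓ  m  p∈ℓ  in subst (_∈ℓ ℓ′) (sym e) (representation-on-line ℓ′ m′ r)) ,
    (λ p∈ℓ′ → let r , e = representation-spans ℓ′ m′ p∈ℓ′ in subst (_∈ℓ ℓ) (sym e) (representation-on-line ℓ  m  r))

  length-representations : ∀ ℓ → length (representations ℓ) ≡ size ℕ.* length units
  length-representations ℓ = trans (length-map (representation ℓ) (cartesianProduct allScalars units))
    (trans (length-cartesianProduct allScalars units) (cong (ℕ._* length units) length-scalars))

  lineRepresentations : List (Line F) → List (Point F × Point F)
  lineRepresentations L = concat (map representations L)

  lineRepresentations-unique : ∀ L → DistinctLines F L → Unique (lineRepresentations L)
  lineRepresentations-unique L distinct = Unique.concat⁺
    (All.map⁺ (All.tabulate λ {ℓ} _ → representations-unique ℓ))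
    (AllPairs.map⁺ (AllPairs.map (λ {ℓ} {ℓ′} → representations-disjoint ℓ ℓ′) distinct))

  length-lineRepresentations : ∀ L → length (lineRepresentations L) ≡ length L ℕ.* (size ℕ.* length units)
  length-lineRepresentations []      = refl
  length-lineRepresentations (ℓ ∷ L) = trans (length-++ (representations ℓ))
    (cong₂ ℕ._+_ (length-representations ℓ) (length-lineRepresentations L))

  lineRepresentations-covered : ∀ L {a v} → (a , v) ∈ lineRepresentations L → ∀ r → InUnion F L (a ⊕ r · v)
  lineRepresentations-covered L m r
    with reps , m′ , reps∈ ← ∈-concat⁻′ (map representations L) m
    with ℓ , ℓ∈L , refl ← ∈-map⁻ representations reps∈ = ℓ , ℓ∈L , representation-on-line ℓ m′ r


module MissedPoints (F : FiniteField) (L : List (Line F)) where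
  open FiniteSums
  open DensityBounds
  open AffineSpace F
  open import Data.Nat using (ℕ; suc; _+_; _*_; _^_; _≤_)
  open import Data.Nat.Properties using (+-suc; +-identityʳ; *-identityʳ; +-cancelʳ-≡; ≤-pred)
  open import Data.Nat.Tactic.RingSolver using (solve-∀)
  open import Data.List using (List; []; _∷_; length; filter)
  open import Data.List.Membership.Propositional using (_∈_)
  open import Data.Product using (_×_; _,_; proj₁; proj₂)
  open import Data.Empty using (⊥-elim)
  open import Function using (_∘_)
  open import Relation.Nullary using (yes; no)
  open import Relation.Binary.PropositionalEquality
  open FiniteField F using (Carrier; size)

  missed : Point F → ℕ
  missed p with inUnion? L p
  ... | yes _ = 0
  ... | no  _ = 1

  missed-covered : ∀ {p} → InUnion F L p → missed p ≡ 0
  missed-covered {p} p∈L with inUnion? L p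
  ... | yes _   = refl
  ... | no  p∉L = ⊥-elim (p∉L p∈L)

  missed² : ∀ p → missed p * missed p ≡ missed p
  missed² p with inUnion? L p
  ... | yes _ = refl
  ... | no  _ = refl

  covered : List (Point F)
  covered = filter (inUnion? L) allPoints

  q p Q c : ℕ
  q = size
  p = length units
  Q = length allPoints
  c = ∑ allPoints missed

  missed+covered : c + length covered ≡ Q
  missed+covered = go allPoints
    where
    go : ∀ xs → ∑ xs missed + length (filter (inUnion? L) xs) ≡ length xs
    go []       = refl
    go (x ∷ xs) with inUnion? L x
    ... | yes _ = trans (+-suc _ _) (cong suc (go xs))
    ... | no  _ = cong suc (go xs)

  pairs : Enumeration (Point F × Point F)
  pairs = ×-enumeration points points

  open Enumeration pairs using () renaming (elements to allPairs)

  -- Pairs with v = 0 are included, so that sums over pairs are sums over all of F³ × F³.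
  missedOn : Point F × Point F → ℕ
  missedOn (a , v) = ∑ allScalars (λ r → missed (a ⊕ r · v))

  ∑-missed-along : ∀ r → ∑ allPairs (λ d → missed (proj₁ d ⊕ r · proj₂ d)) ≡ c * Q
  ∑-missed-along r = begin
    ∑ allPairs (λ d → missed (proj₁ d ⊕ r · proj₂ d))           ≡⟨ ∑-cartesianProduct allPoints allPoints _ ⟩
    ∑ allPoints (λ a → ∑ allPoints (λ v → missed (a ⊕ r · v)))  ≡⟨ ∑-swap allPoints allPoints _ ⟩
    ∑ allPoints (λ v → ∑ allPoints (λ a → missed (a ⊕ r · v)))  ≡⟨ ∑-cong allPoints (λ v → ∑-translate (r · v) missed) ⟩
    ∑ allPoints (λ _ → c)                                       ≡⟨ ∑-const allPoints c ⟩
    c * Q                                                       ∎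
    where open ≡-Reasoning

  first-moment : ∑ allPairs missedOn ≡ q * c * Q
  first-moment = begin
    ∑ allPairs missedOn                                                   ≡⟨ ∑-swap allPairs allScalars _ ⟩
    ∑ allScalars (λ r → ∑ allPairs (λ d → missed (proj₁ d ⊕ r · proj₂ d))) ≡⟨ ∑-cong allScalars ∑-missed-along ⟩
    ∑ allScalars (λ _ → c * Q)                                            ≡⟨ ∑-const allScalars (c * Q) ⟩
    c * Q * length allScalars                                             ≡⟨ cong (c * Q *_) length-scalars ⟩
    c * Q * q                                                             ≡⟨ rotate c Q q ⟩
    q * c * Q                                                             ∎
    where
    open ≡-Reasoning
    rotate : ∀ c Q q → c * Q * q ≡ q * c * Q
    rotate = solve-∀

  jointlyMissed : Carrier → Carrier → ℕ
  jointlyMissed r s = ∑ allPairs (λ d → missed (proj₁ d ⊕ r · proj₂ d) * missed (proj₁ d ⊕ s · proj₂ d))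

  jointlyMissed-≡ : ∀ r → jointlyMissed r r ≡ c * Q
  jointlyMissed-≡ r = trans (∑-cong allPairs (λ d → missed² _)) (∑-missed-along r)

  jointlyMissed-≢ : ∀ r s → r ≢ s → jointlyMissed r s ≡ c * c
  jointlyMissed-≢ r s r≢s = begin
    jointlyMissed r s
      ≡⟨ ∑-cartesianProduct allPoints allPoints _ ⟩
    ∑ allPoints (λ a → ∑ allPoints (λ v → missed (a ⊕ r · v) * missed (a ⊕ s · v)))
      ≡⟨ ∑-swap allPoints allPoints _ ⟩
    ∑ allPoints (λ v → ∑ allPoints (λ a → missed (a ⊕ r · v) * missed (a ⊕ s · v)))
      ≡⟨ ∑-cong allPoints (λ v → ∑-cong allPoints (λ a →
           cong (λ x → missed (a ⊕ r · v) * missed x) (⊕-·-shift a r s v))) ⟨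
    ∑ allPoints (λ v → ∑ allPoints (λ a → missed (a ⊕ r · v) * missed (a ⊕ r · v ⊕ (s - r) · v)))
      ≡⟨ ∑-cong allPoints (λ v → ∑-translate (r · v) (λ b → missed b * missed (b ⊕ (s - r) · v))) ⟩
    ∑ allPoints (λ v → ∑ allPoints (λ b → missed b * missed (b ⊕ (s - r) · v)))
      ≡⟨ ∑-swap allPoints allPoints _ ⟩
    ∑ allPoints (λ b → ∑ allPoints (λ v → missed b * missed (b ⊕ (s - r) · v)))
      ≡⟨ ∑-cong allPoints (λ b → ∑-*ˡ allPoints (missed b) _) ⟩
    ∑ allPoints (λ b → missed b * ∑ allPoints (λ v → missed (b ⊕ (s - r) · v)))
      ≡⟨ ∑-cong allPoints (λ b → cong (missed b *_) (∑-sweep b (-≢0 r≢s) missed)) ⟩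
    ∑ allPoints (λ b → missed b * c)
      ≡⟨ ∑-*ʳ allPoints c missed ⟩
    c * c
      ∎
    where open ≡-Reasoning

  module S = Enumerated scalars

  -- Adding δ s r · c² on both sides separates the diagonal s = r without truncated subtraction.
  row-sum : ∀ r → ∑ allScalars (jointlyMissed r) ≡ c * Q + p * (c * c)
  row-sum r = +-cancelʳ-≡ (c * c) _ _ (begin
    ∑ allScalars (jointlyMissed r) + c * c
      ≡⟨ cong (∑ allScalars (jointlyMissed r) +_) (S.∑-δ r (λ _ → c * c)) ⟨
    ∑ allScalars (jointlyMissed r) + ∑ allScalars (λ s → S.δ s r * (c * c))
      ≡⟨ ∑-+ allScalars _ _ ⟨
    ∑ allScalars (λ s → jointlyMissed r s + S.δ s r * (c * c))
      ≡⟨ ∑-cong allScalars split ⟩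
    ∑ allScalars (λ s → S.δ s r * (c * Q) + c * c)
      ≡⟨ ∑-+ allScalars _ _ ⟩
    ∑ allScalars (λ s → S.δ s r * (c * Q)) + ∑ allScalars (λ _ → c * c)
      ≡⟨ cong₂ _+_ (S.∑-δ r (λ _ → c * Q)) (∑-const allScalars (c * c)) ⟩
    c * Q + c * c * length allScalars
      ≡⟨ cong (λ n → c * Q + c * c * n) (trans length-scalars (sym suc-length-units)) ⟩
    c * Q + c * c * suc p
      ≡⟨ peel (c * Q) (c * c) p ⟩
    c * Q + p * (c * c) + c * c
      ∎)
    where
    open ≡-Reasoning
    peel : ∀ x y p → x + y * suc p ≡ x + p * y + y
    peel = solve-∀
    split : ∀ s → jointlyMissed r s + S.δ s r * (c * c) ≡ S.δ s r * (c * Q) + c * c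
    split s with s ≟ r
    ... | yes refl = trans (cong (_+ 1 * (c * c)) (jointlyMissed-≡ s)) (swap (c * Q) (c * c))
      where
      swap : ∀ x y → x + 1 * y ≡ 1 * x + y
      swap = solve-∀
    ... | no  s≢r  = trans (+-identityʳ _) (jointlyMissed-≢ r s (s≢r ∘ sym))

  second-moment : ∑ allPairs (λ d → missedOn d * missedOn d) ≡ q * c * (Q + p * c)
  second-moment = begin
    ∑ allPairs (λ d → missedOn d * missedOn d)
      ≡⟨ ∑-cong allPairs expand ⟩
    ∑ allPairs (λ d → ∑ allScalars (λ r → ∑ allScalars (λ s → along r d * along s d)))
      ≡⟨ ∑-swap allPairs allScalars _ ⟩
    ∑ allScalars (λ r → ∑ allPairs (λ d → ∑ allScalars (λ s → along r d * along s d)))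
      ≡⟨ ∑-cong allScalars (λ r → ∑-swap allPairs allScalars _) ⟩
    ∑ allScalars (λ r → ∑ allScalars (jointlyMissed r))
      ≡⟨ ∑-cong allScalars row-sum ⟩
    ∑ allScalars (λ _ → c * Q + p * (c * c))
      ≡⟨ ∑-const allScalars _ ⟩
    (c * Q + p * (c * c)) * length allScalars
      ≡⟨ cong ((c * Q + p * (c * c)) *_) length-scalars ⟩
    (c * Q + p * (c * c)) * q
      ≡⟨ factor c Q p q ⟩
    q * c * (Q + p * c)
      ∎
    where
    open ≡-Reasoning
    along : Carrier → Point F × Point F → ℕ
    along r d = missed (proj₁ d ⊕ r · proj₂ d)
    expand : ∀ d → missedOn d * missedOn d ≡ ∑ allScalars (λ r → ∑ allScalars (λ s → along r d * along s d))
    expand d = trans (sym (∑-*ʳ allScalars (missedOn d) (λ r → along r d)))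
                     (∑-cong allScalars (λ r → sym (∑-*ˡ allScalars (along r d) (λ s → along s d))))
    factor : ∀ c Q p q → (c * Q + p * (c * c)) * q ≡ q * c * (Q + p * c)
    factor = solve-∀

  missedOn-representation : ∀ {d} → d ∈ lineRepresentations L → missedOn d ≡ 0
  missedOn-representation {a , v} d∈R = ∑-zero allScalars λ {r} _ → missed-covered (lineRepresentations-covered L d∈R r)

  moment-inequality : DistinctLines F L → let S₁ = q * c * Q in
    length L * (q * p) * (S₁ * S₁) + Q * Q * (S₁ * S₁) ≤ Q * Q * (Q * Q) * (q * c * (Q + p * c))
  moment-inequality distinct =
    subst₂ _≤_ (cong₂ _+_ (cong₂ _*_ (length-lineRepresentations L) S₁²) (cong₂ _*_ length-pairs S₁²))
               (cong₂ _*_ (cong₂ _*_ length-pairs length-pairs) second-moment)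
      (chebyshev-zeros pairs missedOn (lineRepresentations L) (lineRepresentations-unique L distinct)
                       missedOn-representation)
    where
    S₁² = cong₂ _*_ first-moment first-moment
    length-pairs : length allPairs ≡ Q * Q
    length-pairs = length-cartesianProduct allPoints allPoints

  covered-lower-bound : 88 ≤ q → DistinctLines F L → 62 * q ^ 3 ≤ 100 * length L → 38 * q ^ 3 ≤ 100 * length covered
  covered-lower-bound 88≤q distinct 62q³≤100L = subst (λ x → 38 * x ≤ 100 * length covered) Q≡q³
    (covered-density p c (length covered) (length L) Q q≡1+p 87≤p missed+covered 62Q≤100L missed-estimate)
    where
    q≡1+p : q ≡ suc p
    q≡1+p = sym suc-length-units
    87≤p : 87 ≤ p
    87≤p = ≤-pred (subst (88 ≤_) q≡1+p 88≤q)
    Q≡q³ : Q ≡ q ^ 3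
    Q≡q³ = trans length-points (cong (λ x → q * (q * x)) (sym (*-identityʳ q)))
    62Q≤100L : 62 * Q ≤ 100 * length L
    62Q≤100L = subst (λ x → 62 * x ≤ 100 * length L) (sym Q≡q³) 62q³≤100L
    missed-estimate : p * c * length L ≤ q * Q * length covered
    missed-estimate = missed-bound p c (length covered) (length L) q≡1+p length-points missed+covered
                                   (moment-inequality distinct)


open FiniteSums using (Enumeration)
open import Data.Nat using (ℕ; suc; _*_; _^_; _≤_)
open import Data.Nat.Properties using (*-mono-≤; n≤1+n)
open import Data.Product using (_×_; ∃; _,_)
open import Data.List.Relation.Unary.All using (All)
open import Data.List.Relation.Unary.All.Properties using (all-filter)
open import Data.List.Relation.Unary.Unique.Propositional using (Unique)
import Data.List.Relation.Unary.Unique.Propositional.Properties as Unique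

proposition1 : ∀ (k : ℕ) → ∃ λ (Q : ℕ) →
    ∀ (F : FiniteField) → Q ≤ FiniteField.size F →
    ∀ (L : List (Line F)) → DistinctLines F L →
    62 * FiniteField.size F ^ 3 ≤ 100 * length L →
    ∃ λ (pts : List (Point F)) → Unique pts × All (InUnion F L) pts ×
      (k * (38 * FiniteField.size F ^ 3) ≤ suc k * (100 * length pts))
proposition1 k = 88 , λ F 88≤q L distinct 62q³≤100L →
  let open AffineSpace F
      open MissedPoints F L
  in covered , Unique.filter⁺ (inUnion? L) (Enumeration.unique points) , all-filter (inUnion? L) allPoints ,
     *-mono-≤ (n≤1+n k) (covered-lower-bound 88≤q distinct 62q³≤100L)
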